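{- For every integer $k$ there is a position of \textsc{blocking pebbles} whose (normal-play combinatorial) game value is $k$.
   Context: \textsc{Blocking pebbles} is a two-player game between Left and Right. A position is a finite directed acyclic graph $G$ together with, at each vertex $v$, a triple $(b,r,g)$ of non-negative integers giving the numbers of blue, red and green pebbles on $v$. An in-neighbour of $v$ is a vertex $u$ with an arc $u\to v$; an out-neighbour is a vertex $w$ with an arc $v\to w$. On her turn Left chooses a vertex $v$ and either (1) moves a positive number of blue and/or green pebbles from $v$ to a single in-neighbour of $v$ (at no cost), or (2) removes two blue and/or green pebbles from $v$ and places one pebble (of one of the removed colours) on an out-neighbour of $v$. Blocking rule: no blue pebble may be moved onto a vertex that currently carries a non-zero number of red pebbles. Right has the symmetric moves with red and green pebbles, and no red pebble may be moved onto a vertex carrying a non-zero number of blue pebbles. Green pebbles are never blocked. Normal play: the player who makes the last move wins. Game values are in the sense of Conway's combinatorial game theory ($\{L\mid R\}$ notation, integers, nimbers $*n$). -}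

module Defs where

open import Data.Nat using (ℕ; zero; suc; _+_; _∸_; _≤_; _<_)
open import Data.Integer using (ℤ; +_; -[1+_]; -_)
open import Data.Fin using (Fin; _≟_)
open import Data.Bool using (Bool; true; false; if_then_else_)
open import Data.Product using (_×_; _,_)
open import Relation.Nullary using (¬_)
open import Relation.Nullary.Decidable using (⌊_⌋)
open import Relation.Binary.PropositionalEquality using (_≡_)
open import Relation.Binary.Construct.Closure.Transitive using (TransClosure)

record Game : Set₁ where
  field
    Pos   : Set
    LMove : Pos → Pos → Set
    RMove : Pos → Pos → Set
open Game public

data SumL (G H : Game) : Pos G × Pos H → Pos G × Pos H → Set where
  inl : ∀ {g g' h} → LMove G g g' → SumL G H (g , h) (g' , h)
  inr : ∀ {g h h'} → LMove H h h' → SumL G H (g , h) (g , h')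

data SumR (G H : Game) : Pos G × Pos H → Pos G × Pos H → Set where
  inl : ∀ {g g' h} → RMove G g g' → SumR G H (g , h) (g' , h)
  inr : ∀ {g h h'} → RMove H h h' → SumR G H (g , h) (g , h')

_⊕_ : Game → Game → Game
G ⊕ H = record { Pos = Pos G × Pos H ; LMove = SumL G H ; RMove = SumR G H }

-- Winning (normal play: a player unable to move loses).
mutual
  data LWinsFirst (G : Game) (p : Pos G) : Set where
    lmove : ∀ q → LMove G p q → LWinsSecond G q → LWinsFirst G p

  data LWinsSecond (G : Game) (p : Pos G) : Set where
    lreply : (∀ q → RMove G p q → LWinsFirst G q) → LWinsSecond G p

mutual
  data RWinsFirst (G : Game) (p : Pos G) : Set where
    rmove : ∀ q → RMove G p q → RWinsSecond G q → RWinsFirst G p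

  data RWinsSecond (G : Game) (p : Pos G) : Set where
    rreply : (∀ q → LMove G p q → RWinsFirst G q) → RWinsSecond G p

-- The integers as games: position m has value m.
-- n+1 = { n | },  0 = { | },  -(n+1) = { | -n }.
data IntL : ℤ → ℤ → Set where
  dec : ∀ n → IntL (+ suc n) (+ n)

data IntR : ℤ → ℤ → Set where
  inc0 : IntR -[1+ 0 ] (+ 0)
  inc  : ∀ n → IntR -[1+ suc n ] -[1+ n ]

IntGame : Game
IntGame = record { Pos = ℤ ; LMove = IntL ; RMove = IntR }

-- Conway equality with an integer: position p of G has value k iff
-- G + (-k) is a second-player win (a zero game).
HasValue : (G : Game) → Pos G → ℤ → Set
HasValue G p k =
  LWinsSecond (G ⊕ IntGame) (p , - k) × RWinsSecond (G ⊕ IntGame) (p , - k)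

record Pebbles : Set where
  constructor peb
  field
    blue  : ℕ
    red   : ℕ
    green : ℕ
open Pebbles public

Config : ℕ → Set
Config n = Fin n → Pebbles

Arcs : ℕ → Set
Arcs n = Fin n → Fin n → Bool

Arc : ∀ {n} → Arcs n → Fin n → Fin n → Set
Arc a u v = a u v ≡ true

Acyclic : ∀ {n} → Arcs n → Set
Acyclic {n} a = ∀ (v : Fin n) → ¬ TransClosure (Arc a) v v

adjust : ∀ {n} → Fin n → (Pebbles → Pebbles) → Config n → Config n
adjust v f c u = if ⌊ u ≟ v ⌋ then f (c u) else c u

addP : ℕ → ℕ → ℕ → Pebbles → Pebbles
addP x y z (peb b r g) = peb (b + x) (r + y) (g + z)

subP : ℕ → ℕ → ℕ → Pebbles → Pebbles
subP x y z (peb b r g) = peb (b ∸ x) (r ∸ y) (g ∸ z)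

data LeftMove {n} (a : Arcs n) : Config n → Config n → Set where
  shift : ∀ c u v x y → Arc a u v →
          x ≤ blue (c v) → y ≤ green (c v) → 1 ≤ x + y →
          (0 < x → red (c u) ≡ 0) →
          LeftMove a c (adjust u (addP x 0 y) (adjust v (subP x 0 y) c))
  jumpBlue : ∀ c v w x y → Arc a v w →
          x ≤ blue (c v) → y ≤ green (c v) → x + y ≡ 2 → 1 ≤ x →
          red (c w) ≡ 0 →
          LeftMove a c (adjust w (addP 1 0 0) (adjust v (subP x 0 y) c))
  jumpGreen : ∀ c v w x y → Arc a v w →
          x ≤ blue (c v) → y ≤ green (c v) → x + y ≡ 2 → 1 ≤ y →
          LeftMove a c (adjust w (addP 0 0 1) (adjust v (subP x 0 y) c))

data RightMove {n} (a : Arcs n) : Config n → Config n → Set where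
  shift : ∀ c u v x y → Arc a u v →
          x ≤ red (c v) → y ≤ green (c v) → 1 ≤ x + y →
          (0 < x → blue (c u) ≡ 0) →
          RightMove a c (adjust u (addP 0 x y) (adjust v (subP 0 x y) c))
  jumpRed : ∀ c v w x y → Arc a v w →
          x ≤ red (c v) → y ≤ green (c v) → x + y ≡ 2 → 1 ≤ x →
          blue (c w) ≡ 0 →
          RightMove a c (adjust w (addP 0 1 0) (adjust v (subP 0 x y) c))
  jumpGreen : ∀ c v w x y → Arc a v w →
          x ≤ red (c v) → y ≤ green (c v) → x + y ≡ 2 → 1 ≤ y →
          RightMove a c (adjust w (addP 0 0 1) (adjust v (subP 0 x y) c))

record BPPosition : Set where
  constructor bp
  field
    size    : ℕ
    arcs    : Arcs size
    acyclic : Acyclic arcs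
    config  : Config size
open BPPosition public

data BPL : BPPosition → BPPosition → Set where
  mv : ∀ {n a d c c'} → LeftMove {n} a c c' → BPL (bp n a d c) (bp n a d c')

data BPR : BPPosition → BPPosition → Set where
  mv : ∀ {n a d c c'} → RightMove {n} a c c' → BPR (bp n a d c) (bp n a d c')

BlockingPebbles : Game
BlockingPebbles = record { Pos = BPPosition ; LMove = BPL ; RMove = BPR }

module Submission where

-- A single blue pebble on the last vertex of a directed path with n + 1 vertices is the
-- integer n: Right can never move, and each Left move slides the pebble one arc back
-- towards the source, so the game is a countdown of exactly n Left moves.  Against
-- G + (-n) the second player therefore wins by answering every move in one component
-- with the matching move in the other.  Swapping colours gives the negative integers.

open import Defs
open import Data.Bool using (true; false; if_then_else_)
open import Data.Bool.Properties using (T-≡)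
open import Data.Empty using (⊥-elim)
open import Data.Fin using (Fin; toℕ; inject₁) renaming (_≟_ to _≟ᶠ_)
import Data.Fin as Fin
open import Data.Fin.Properties using (toℕ-inject₁; toℕ-fromℕ)
open import Data.Integer using (ℤ; +_; -[1+_]; -_)
open import Data.Integer.Properties using (neg-involutive)
open import Data.Nat using (ℕ; zero; suc; _+_; _≤_; _<_; z≤n; s≤s) renaming (_≟_ to _≟ⁿ_)
open import Data.Nat.Properties
  using (≤-refl; ≤-reflexive; ≤-trans; ≤-antisym; <-trans; <-irrefl; +-mono-≤; +-identityʳ; n≤0⇒n≡0; 1+n≢n; 0≢1+n)
open import Data.Product using (Σ; Σ-syntax; _×_; _,_)
open import Function.Bundles using (Equivalence)
open import Relation.Nullary using (¬_; yes; no)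
open import Relation.Nullary.Decidable using (⌊_⌋; toWitness; fromWitness)
open import Relation.Binary.PropositionalEquality using (_≡_; _≢_; _≗_; refl; sym; trans; cong; subst)
open import Relation.Binary.Construct.Closure.Transitive using (TransClosure; [_]; _∷_)

int-step : ∀ n → IntR (- (+ suc n)) (- (+ n))
int-step zero    = inc0
int-step (suc n) = inc n

module LeftCountdown
  (G : Game) (Stage : ℕ → Pos G → Set)
  (right-stuck    : ∀ {n p q} → Stage n p → ¬ RMove G p q)
  (left-steps     : ∀ {n p q} → Stage n p → LMove G p q → Σ[ m ∈ ℕ ] n ≡ suc m × Stage m q)
  (left-can-step  : ∀ {n p} → Stage (suc n) p → Σ[ q ∈ Pos G ] LMove G p q × Stage n q)
  where

  private mutual
    left-wins : ∀ {n p} → Stage n p → LWinsSecond (G ⊕ IntGame) (p , - (+ n))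
    left-wins s = lreply (answer s)

    answer : ∀ {n p} → Stage n p → ∀ q → RMove (G ⊕ IntGame) (p , - (+ n)) q → LWinsFirst (G ⊕ IntGame) q
    answer s _ (inl r) = ⊥-elim (right-stuck s r)
    answer {zero}        s _ (inr ())
    answer {suc zero}    s _ (inr inc0)     = step-down s
    answer {suc (suc n)} s _ (inr (inc .n)) = step-down s

    step-down : ∀ {n p} → Stage (suc n) p → LWinsFirst (G ⊕ IntGame) (p , - (+ n))
    step-down s with left-can-step s
    ... | q , l , s′ = lmove _ (inl l) (left-wins s′)

  private mutual
    right-wins : ∀ {n p} → Stage n p → RWinsSecond (G ⊕ IntGame) (p , - (+ n))
    right-wins s = rreply (reply s)

    reply : ∀ {n p} → Stage n p → ∀ q → LMove (G ⊕ IntGame) (p , - (+ n)) q → RWinsFirst (G ⊕ IntGame) q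
    reply s (q , _) (inl l) with left-steps s l
    ... | m , refl , s′ = rmove (q , - (+ m)) (inr (int-step m)) (right-wins s′)
    reply {zero}  s _ (inr ())
    reply {suc n} s _ (inr ())

  countdown-value : ∀ {n p} → Stage n p → HasValue G p (+ n)
  countdown-value s = left-wins s , right-wins s

module RightCountdown
  (G : Game) (Stage : ℕ → Pos G → Set)
  (left-stuck     : ∀ {n p q} → Stage n p → ¬ LMove G p q)
  (right-steps    : ∀ {n p q} → Stage n p → RMove G p q → Σ[ m ∈ ℕ ] n ≡ suc m × Stage m q)
  (right-can-step : ∀ {n p} → Stage (suc n) p → Σ[ q ∈ Pos G ] RMove G p q × Stage n q)
  where

  private mutual
    left-wins : ∀ {n p} → Stage n p → LWinsSecond (G ⊕ IntGame) (p , + n)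
    left-wins s = lreply (reply s)

    reply : ∀ {n p} → Stage n p → ∀ q → RMove (G ⊕ IntGame) (p , + n) q → LWinsFirst (G ⊕ IntGame) q
    reply s (q , _) (inl r) with right-steps s r
    ... | m , refl , s′ = lmove (q , + m) (inr (dec m)) (left-wins s′)
    reply s _ (inr ())

  private mutual
    right-wins : ∀ {n p} → Stage n p → RWinsSecond (G ⊕ IntGame) (p , + n)
    right-wins s = rreply (answer s)

    answer : ∀ {n p} → Stage n p → ∀ q → LMove (G ⊕ IntGame) (p , + n) q → RWinsFirst (G ⊕ IntGame) q
    answer s _ (inl l) = ⊥-elim (left-stuck s l)
    answer {suc n} s _ (inr (dec .n)) = step-down s

    step-down : ∀ {n p} → Stage (suc n) p → RWinsFirst (G ⊕ IntGame) (p , + n)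
    step-down s with right-can-step s
    ... | q , r , s′ = rmove _ (inl r) (right-wins s′)

  countdown-value : ∀ {n p} → Stage n p → HasValue G p (- (+ n))
  countdown-value {n} {p} s =
    subst (λ k → LWinsSecond (G ⊕ IntGame) (p , k)) (sym (neg-involutive (+ n))) (left-wins s) ,
    subst (λ k → RWinsSecond (G ⊕ IntGame) (p , k)) (sym (neg-involutive (+ n))) (right-wins s)

one-pebble-cannot-jump : ∀ {x y b g} → x ≤ b → y ≤ g → b ≤ 1 → g ≤ 0 → x + y ≢ 2
one-pebble-cannot-jump hx hy b≤1 g≤0 two =
  <-irrefl refl (subst (_≤ 1) two (+-mono-≤ (≤-trans hx b≤1) (≤-trans hy g≤0)))

left-moves-single-blue : ∀ {N} {a : Arcs N} {c c′ : Config N} →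
  (∀ v → blue (c v) ≤ 1) → (∀ v → green (c v) ≤ 0) → LeftMove a c c′ →
  Σ[ u ∈ Fin N ] Σ[ v ∈ Fin N ]
    Arc a u v × blue (c v) ≡ 1 × c′ ≡ adjust u (addP 1 0 0) (adjust v (subP 1 0 0) c)
left-moves-single-blue few no-green (shift c u v x y arc hx hy pos _)
  with n≤0⇒n≡0 (≤-trans hy (no-green v))
... | refl with ≤-antisym (≤-trans hx (few v)) (subst (1 ≤_) (+-identityʳ x) pos)
... | refl = u , v , arc , ≤-antisym (few v) hx , refl
left-moves-single-blue few no-green (jumpBlue _ v _ _ _ _ hx hy two _ _) =
  ⊥-elim (one-pebble-cannot-jump hx hy (few v) (no-green v) two)
left-moves-single-blue few no-green (jumpGreen _ v _ _ _ _ hx hy two _) =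
  ⊥-elim (one-pebble-cannot-jump hx hy (few v) (no-green v) two)

right-moves-single-red : ∀ {N} {a : Arcs N} {c c′ : Config N} →
  (∀ v → red (c v) ≤ 1) → (∀ v → green (c v) ≤ 0) → RightMove a c c′ →
  Σ[ u ∈ Fin N ] Σ[ v ∈ Fin N ]
    Arc a u v × red (c v) ≡ 1 × c′ ≡ adjust u (addP 0 1 0) (adjust v (subP 0 1 0) c)
right-moves-single-red few no-green (shift c u v x y arc hx hy pos _)
  with n≤0⇒n≡0 (≤-trans hy (no-green v))
... | refl with ≤-antisym (≤-trans hx (few v)) (subst (1 ≤_) (+-identityʳ x) pos)
... | refl = u , v , arc , ≤-antisym (few v) hx , refl
right-moves-single-red few no-green (jumpRed _ v _ _ _ _ hx hy two _ _) =
  ⊥-elim (one-pebble-cannot-jump hx hy (few v) (no-green v) two)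
right-moves-single-red few no-green (jumpGreen _ v _ _ _ _ hx hy two _) =
  ⊥-elim (one-pebble-cannot-jump hx hy (few v) (no-green v) two)

path : ∀ N → Arcs N
path N u v = ⌊ suc (toℕ u) ≟ⁿ toℕ v ⌋

module _ {N : ℕ} {u v : Fin N} where

  path-arc⇒ : Arc (path N) u v → suc (toℕ u) ≡ toℕ v
  path-arc⇒ arc = toWitness (Equivalence.from T-≡ arc)

  ⇒path-arc : suc (toℕ u) ≡ toℕ v → Arc (path N) u v
  ⇒path-arc e = Equivalence.to T-≡ (fromWitness e)

  path-arc-≢ : Arc (path N) u v → u ≢ v
  path-arc-≢ arc refl = 1+n≢n (path-arc⇒ arc)

path-ascends : ∀ {N} {u v : Fin N} → TransClosure (Arc (path N)) u v → toℕ u < toℕ v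
path-ascends [ arc ] = ≤-reflexive (path-arc⇒ arc)
path-ascends (arc ∷ arcs) = <-trans (≤-reflexive (path-arc⇒ arc)) (path-ascends arcs)

path-acyclic : ∀ {N} → Acyclic (path N)
path-acyclic v cycle = <-irrefl refl (path-ascends cycle)

path-predecessor : ∀ {N n} (v : Fin N) → toℕ v ≡ suc n → Σ[ u ∈ Fin N ] Arc (path N) u v × toℕ u ≡ n
path-predecessor (Fin.suc u) refl = inject₁ u , ⇒path-arc (cong suc (toℕ-inject₁ u)) , toℕ-inject₁ u

onPath : ∀ {N} → Config N → BPPosition
onPath {N} c = bp N (path N) path-acyclic c

empty : Pebbles
empty = peb 0 0 0

lone : ∀ {N} → Pebbles → Fin N → Config N
lone p v w = if ⌊ w ≟ᶠ v ⌋ then p else empty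

module _ {N : ℕ} {p : Pebbles} {v : Fin N} where

  lone-self : ∀ {w} → w ≡ v → lone p v w ≡ p
  lone-self refl with v ≟ᶠ v
  ... | yes _ = refl
  ... | no v≢v = ⊥-elim (v≢v refl)

  lone-elsewhere : ∀ {w} → w ≢ v → lone p v w ≡ empty
  lone-elsewhere {w} w≢v with w ≟ᶠ v
  ... | yes w≡v = ⊥-elim (w≢v w≡v)
  ... | no _ = refl

  lone-all : (P : Pebbles → Set) → P p → P empty → ∀ {c : Config N} → c ≗ lone p v → ∀ w → P (c w)
  lone-all P Pp Pempty c≗ w = subst P (sym (c≗ w)) (choose (⌊ w ≟ᶠ v ⌋))
    where
    choose : ∀ b → P (if b then p else empty)
    choose true = Pp
    choose false = Pempty

  module _ {c : Config N} (c≗ : c ≗ lone p v) where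

    lone-blue≤ : ∀ w → blue (c w) ≤ blue p
    lone-blue≤ = lone-all (λ q → blue q ≤ blue p) ≤-refl z≤n c≗

    lone-red≤ : ∀ w → red (c w) ≤ red p
    lone-red≤ = lone-all (λ q → red q ≤ red p) ≤-refl z≤n c≗

    lone-green≤ : ∀ w → green (c w) ≤ green p
    lone-green≤ = lone-all (λ q → green q ≤ green p) ≤-refl z≤n c≗

  lone-support : ∀ {c : Config N} {w} → c ≗ lone p v → c w ≢ empty → w ≡ v
  lone-support {w = w} c≗ occupied with w ≟ᶠ v
  ... | yes w≡v = w≡v
  ... | no w≢v = ⊥-elim (occupied (trans (c≗ w) (lone-elsewhere w≢v)))

data LoneOnPath (p : Pebbles) (n : ℕ) : BPPosition → Set where
  lone-at : ∀ {N} {c : Config N} (v : Fin N) → toℕ v ≡ n → c ≗ lone p v → LoneOnPath p n (onPath c)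

lone-shift : ∀ {N p} {c : Config N} {u v : Fin N} (f g : Pebbles → Pebbles) →
  g p ≡ empty → f empty ≡ p → c ≗ lone p v → Arc (path N) u v →
  LoneOnPath p (toℕ u) (onPath (adjust u f (adjust v g c)))
lone-shift {p = p} {c} {u} {v} f g gp≡empty fempty≡p c≗ arc = lone-at u refl shifted
  where
  shifted : adjust u f (adjust v g c) ≗ lone p u
  shifted w with w ≟ᶠ u | w ≟ᶠ v
  ... | yes w≡u | yes w≡v = ⊥-elim (path-arc-≢ arc (trans (sym w≡u) w≡v))
  ... | yes _   | no w≢v  = trans (cong f (trans (c≗ w) (lone-elsewhere w≢v))) fempty≡p
  ... | no _    | yes w≡v = trans (cong g (trans (c≗ w) (lone-self w≡v))) gp≡empty
  ... | no _    | no w≢v  = trans (c≗ w) (lone-elsewhere w≢v)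

oneBlue oneRed : Pebbles
oneBlue = peb 1 0 0
oneRed  = peb 0 1 0

blue-right-stuck : ∀ {n P Q} → LoneOnPath oneBlue n P → ¬ BPR P Q
blue-right-stuck (lone-at v _ c≗) (mv r)
  with right-moves-single-red (λ w → ≤-trans (lone-red≤ c≗ w) z≤n) (lone-green≤ c≗) r
... | _ , w , _ , red≡1 , _ = <-irrefl refl (subst (_≤ 0) red≡1 (lone-red≤ c≗ w))

blue-steps : ∀ {n P Q} → LoneOnPath oneBlue n P → BPL P Q →
  Σ[ m ∈ ℕ ] n ≡ suc m × LoneOnPath oneBlue m Q
blue-steps (lone-at v refl c≗) (mv l) with left-moves-single-blue (lone-blue≤ c≗) (lone-green≤ c≗) l
... | u , v′ , arc , blue≡1 , refl with lone-support c≗ (λ e → 0≢1+n (trans (sym (cong blue e)) blue≡1))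
... | refl = toℕ u , sym (path-arc⇒ arc) , lone-shift (addP 1 0 0) (subP 1 0 0) refl refl c≗ arc

blue-can-step : ∀ {n P} → LoneOnPath oneBlue (suc n) P →
  Σ[ Q ∈ BPPosition ] BPL P Q × LoneOnPath oneBlue n Q
blue-can-step (lone-at {c = c} v v≡1+n c≗) with path-predecessor v v≡1+n
... | u , arc , refl = onPath _ , mv slide , lone-shift (addP 1 0 0) (subP 1 0 0) refl refl c≗ arc
  where
  slide : LeftMove (path _) c (adjust u (addP 1 0 0) (adjust v (subP 1 0 0) c))
  slide = shift _ u v 1 0 arc (≤-reflexive (sym (cong blue (trans (c≗ v) (lone-self refl))))) z≤n (s≤s z≤n)
                (λ _ → n≤0⇒n≡0 (lone-red≤ c≗ u))

red-left-stuck : ∀ {n P Q} → LoneOnPath oneRed n P → ¬ BPL P Q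
red-left-stuck (lone-at v _ c≗) (mv l)
  with left-moves-single-blue (λ w → ≤-trans (lone-blue≤ c≗ w) z≤n) (lone-green≤ c≗) l
... | _ , w , _ , blue≡1 , _ = <-irrefl refl (subst (_≤ 0) blue≡1 (lone-blue≤ c≗ w))

red-steps : ∀ {n P Q} → LoneOnPath oneRed n P → BPR P Q →
  Σ[ m ∈ ℕ ] n ≡ suc m × LoneOnPath oneRed m Q
red-steps (lone-at v refl c≗) (mv r) with right-moves-single-red (lone-red≤ c≗) (lone-green≤ c≗) r
... | u , v′ , arc , red≡1 , refl with lone-support c≗ (λ e → 0≢1+n (trans (sym (cong red e)) red≡1))
... | refl = toℕ u , sym (path-arc⇒ arc) , lone-shift (addP 0 1 0) (subP 0 1 0) refl refl c≗ arc

red-can-step : ∀ {n P} → LoneOnPath oneRed (suc n) P →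
  Σ[ Q ∈ BPPosition ] BPR P Q × LoneOnPath oneRed n Q
red-can-step (lone-at {c = c} v v≡1+n c≗) with path-predecessor v v≡1+n
... | u , arc , refl = onPath _ , mv slide , lone-shift (addP 0 1 0) (subP 0 1 0) refl refl c≗ arc
  where
  slide : RightMove (path _) c (adjust u (addP 0 1 0) (adjust v (subP 0 1 0) c))
  slide = shift _ u v 1 0 arc (≤-reflexive (sym (cong red (trans (c≗ v) (lone-self refl))))) z≤n (s≤s z≤n)
                (λ _ → n≤0⇒n≡0 (lone-blue≤ c≗ u))

module BlueCountdown = LeftCountdown BlockingPebbles (LoneOnPath oneBlue) blue-right-stuck blue-steps blue-can-step
module RedCountdown  = RightCountdown BlockingPebbles (LoneOnPath oneRed) red-left-stuck red-steps red-can-step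

lone-at-end : ∀ p n → LoneOnPath p n (onPath (lone p (Fin.fromℕ n)))
lone-at-end p n = lone-at (Fin.fromℕ n) (toℕ-fromℕ n) (λ _ → refl)

theorem1 : (k : ℤ) → Σ BPPosition (λ P → HasValue BlockingPebbles P k)
theorem1 (+ n)     = _ , BlueCountdown.countdown-value (lone-at-end oneBlue n)
theorem1 -[1+ n ]  = _ , RedCountdown.countdown-value (lone-at-end oneRed (suc n))
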